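{- Let $H=(X,Y,E)$ be a bipartite graph with parts $X$ and $Y$ such that $N(x_1)\neq N(x_2)$ for all distinct $x_1,x_2\in X$, where $N(x)$ denotes the set of neighbors of $x$. Then $|X|\le \nu(H)+2^{\nu(H)}$, where $\nu(H)$ is the maximum size of a matching in $H$. -}

module Defs where

open import Data.Nat using (ℕ; _≤_)
open import Data.Fin using (Fin)
open import Data.Bool using (Bool; true)
open import Data.Product using (Σ; _×_; ∃)
open import Relation.Binary.PropositionalEquality using (_≡_)
open import Relation.Nullary using (¬_)
open import Function.Definitions using (Injective)

-- A finite bipartite graph H = (X, Y, E) with X = Fin m, Y = Fin n,
-- given by its bipartite adjacency relation (E x y ≡ true iff xy is an edge).
BipGraph : ℕ → ℕ → Set
BipGraph m n = Fin m → Fin n → Bool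

SameNbhd : ∀ {m n} → BipGraph m n → Fin m → Fin m → Set
SameNbhd {n = n} E x₁ x₂ = (y : Fin n) → E x₁ y ≡ E x₂ y

Matching : ∀ {m n} → BipGraph m n → ℕ → Set
Matching {m} {n} E k =
  Σ (Fin k → Fin m) λ f → Σ (Fin k → Fin n) λ g →
    Injective _≡_ _≡_ f × Injective _≡_ _≡_ g × ((i : Fin k) → E (f i) (g i) ≡ true)

IsMatchingNumber : ∀ {m n} → BipGraph m n → ℕ → Set
IsMatchingNumber E k = Matching E k × (∀ j → Matching E j → j ≤ k)

module Submission where

-- Fix a maximum matching {(f i , g i) | i < ν}.  A vertex x ∈ X
-- is either matched, say x = f i, or unmatched.  Two unmatched vertices of X
-- have no neighbours among the unmatched vertices of Y (otherwise the
-- matching could be extended), so the neighbourhood of an unmatched x is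
-- determined by its trace on the matched vertices g 0, …, g (ν-1), a 0/1
-- word of length ν.  Since distinct vertices of X have distinct
-- neighbourhoods, the map sending a matched x = f i to i and an unmatched x
-- to its trace is an injection X → Fin ν ⊎ Fin (2 ^ ν), whence |X| ≤ ν + 2^ν.

open import Defs
open import Data.Nat using (ℕ; suc; _≤_; _+_; _^_)
open import Data.Nat.Properties using (≤⇒≯; ≤-refl)
open import Data.Fin using (Fin; zero; suc; join; splitAt)
open import Data.Fin.Base using (funToFin; finToFun)
open import Data.Fin.Properties
  using (any?; _≟_; splitAt-join; injective⇒≤; finToFun-funToFin; 2↔Bool)
open import Data.Vec.Functional using (_∷_)
open import Data.Bool using (Bool; true; false)
open import Data.Sum using (_⊎_; inj₁; inj₂)
open import Data.Sum.Properties using (inj₁-injective; inj₂-injective)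
open import Data.Product using (_,_; ∃)
open import Data.Empty using (⊥-elim)
open import Function.Bundles using (Inverse)
open import Function.Definitions using (Injective)
open import Relation.Binary.PropositionalEquality
open import Relation.Nullary using (¬_; Dec; yes; no)

InImage : ∀ {A : Set} {k} → (Fin k → A) → A → Set
InImage f x = ∃ λ i → f i ≡ x

∷-injective : ∀ {A : Set} {k} {f : Fin k → A} {x : A} →
              Injective _≡_ _≡_ f → ¬ InImage f x → Injective _≡_ _≡_ (x ∷ f)
∷-injective f-inj x∉f {zero}  {zero}  _  = refl
∷-injective f-inj x∉f {zero}  {suc j} eq = ⊥-elim (x∉f (j , sym eq))
∷-injective f-inj x∉f {suc i} {zero}  eq = ⊥-elim (x∉f (i , eq))
∷-injective f-inj x∉f {suc i} {suc j} eq = cong suc (f-inj eq)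

extendMatching : ∀ {m n k} (E : BipGraph m n)
                 (f : Fin k → Fin m) (g : Fin k → Fin n) →
                 Injective _≡_ _≡_ f → Injective _≡_ _≡_ g →
                 ((i : Fin k) → E (f i) (g i) ≡ true) →
                 ∀ {x y} → ¬ InImage f x → ¬ InImage g y → E x y ≡ true →
                 Matching E (suc k)
extendMatching E f g f-inj g-inj edges {x} {y} x∉f y∉g exy =
  x ∷ f , y ∷ g , ∷-injective f-inj x∉f , ∷-injective g-inj y∉g , edges′
  where
  edges′ : (i : Fin (suc _)) → E ((x ∷ f) i) ((y ∷ g) i) ≡ true
  edges′ zero    = exy
  edges′ (suc i) = edges i

injective-into-⊎⇒≤ : ∀ {m a b} {h : Fin m → Fin a ⊎ Fin b} →
                     Injective _≡_ _≡_ h → m ≤ a + b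
injective-into-⊎⇒≤ {a = a} {b} {h} h-inj =
  injective⇒≤ {f = λ x → join a b (h x)} λ {x₁} {x₂} eq →
    h-inj (begin
      h x₁                        ≡⟨ sym (splitAt-join a b (h x₁)) ⟩
      splitAt a (join a b (h x₁)) ≡⟨ cong (splitAt a) eq ⟩
      splitAt a (join a b (h x₂)) ≡⟨ splitAt-join a b (h x₂) ⟩
      h x₂                        ∎)
  where open ≡-Reasoning

open Inverse 2↔Bool using () renaming (to to bitToBool; from to boolToBit)

encode : ∀ {k} → (Fin k → Bool) → Fin (2 ^ k)
encode w = funToFin (λ i → boolToBit (w i))

encode-injective : ∀ {k} (v w : Fin k → Bool) → encode v ≡ encode w →
                   ∀ i → v i ≡ w i
encode-injective v w eq i = begin
  v i                                   ≡⟨ sym (strictlyInverseˡ (v i)) ⟩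
  bitToBool (boolToBit (v i))           ≡⟨ cong bitToBool (sym (decode v)) ⟩
  bitToBool (finToFun (encode v) i)     ≡⟨ cong (λ c → bitToBool (finToFun c i)) eq ⟩
  bitToBool (finToFun (encode w) i)     ≡⟨ cong bitToBool (decode w) ⟩
  bitToBool (boolToBit (w i))           ≡⟨ strictlyInverseˡ (w i) ⟩
  w i                                   ∎
  where
  open ≡-Reasoning
  open Inverse 2↔Bool using (strictlyInverseˡ)
  decode : ∀ u → finToFun (encode u) i ≡ boolToBit (u i)
  decode u = finToFun-funToFin (λ j → boolToBit (u j)) i

trace : ∀ {m n k} → BipGraph m n → (Fin k → Fin n) → Fin m → Fin (2 ^ k)
trace E g x = encode (λ i → E x (g i))

module MaximumMatching {m n ν : ℕ} (E : BipGraph m n)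
  (f : Fin ν → Fin m) (g : Fin ν → Fin n)
  (f-inj : Injective _≡_ _≡_ f) (g-inj : Injective _≡_ _≡_ g)
  (edges : (i : Fin ν) → E (f i) (g i) ≡ true)
  (maximum : ∀ j → Matching E j → j ≤ ν) where

  unmatched-nonadjacent : ∀ x y → ¬ InImage f x → ¬ InImage g y → E x y ≡ false
  unmatched-nonadjacent x y x∉f y∉g with E x y in exy
  ... | false = refl
  ... | true  = ⊥-elim (≤⇒≯ (maximum (suc ν) bigger) ≤-refl)
    where bigger = extendMatching E f g f-inj g-inj edges x∉f y∉g exy

  -- Two unmatched vertices of X with the same trace on g have the same
  -- neighbourhood: they agree on matched y by the trace, and are both
  -- non-adjacent to unmatched y.
  unmatched-twins : ∀ x₁ x₂ → ¬ InImage f x₁ → ¬ InImage f x₂ →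
                    trace E g x₁ ≡ trace E g x₂ → SameNbhd E x₁ x₂
  unmatched-twins x₁ x₂ x₁∉f x₂∉f same-trace y with any? (λ i → g i ≟ y)
  ... | yes (i , refl) = encode-injective _ _ same-trace i
  ... | no y∉g = trans (unmatched-nonadjacent x₁ y x₁∉f y∉g)
                       (sym (unmatched-nonadjacent x₂ y x₂∉f y∉g))

  classifyBy : ∀ x → Dec (InImage f x) → Fin ν ⊎ Fin (2 ^ ν)
  classifyBy x (yes (i , _)) = inj₁ i
  classifyBy x (no _)        = inj₂ (trace E g x)

  classify : Fin m → Fin ν ⊎ Fin (2 ^ ν)
  classify x = classifyBy x (any? (λ i → f i ≟ x))

  classify-injective : ((x₁ x₂ : Fin m) → x₁ ≢ x₂ → ¬ SameNbhd E x₁ x₂) →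
                       Injective _≡_ _≡_ classify
  classify-injective twin-free {x₁} {x₂} = by-cases (any? _) (any? _)
    where
    by-cases : ∀ d₁ d₂ → classifyBy x₁ d₁ ≡ classifyBy x₂ d₂ → x₁ ≡ x₂
    by-cases (yes (i , fi≡x₁)) (yes (j , fj≡x₂)) eq =
      trans (sym fi≡x₁) (trans (cong f (inj₁-injective eq)) fj≡x₂)
    by-cases (yes _) (no _) ()
    by-cases (no _) (yes _) ()
    by-cases (no x₁∉f) (no x₂∉f) eq with x₁ ≟ x₂
    ... | yes x₁≡x₂ = x₁≡x₂
    ... | no  x₁≢x₂ = ⊥-elim (twin-free x₁ x₂ x₁≢x₂
                        (unmatched-twins x₁ x₂ x₁∉f x₂∉f (inj₂-injective eq)))

lemma3 : (m n : ℕ) (E : BipGraph m n) →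
         ((x₁ x₂ : Fin m) → x₁ ≢ x₂ → ¬ SameNbhd E x₁ x₂) →
         (ν : ℕ) → IsMatchingNumber E ν →
         m ≤ ν + 2 ^ ν
lemma3 m n E twin-free ν ((f , g , f-inj , g-inj , edges) , maximum) =
  injective-into-⊎⇒≤ (classify-injective twin-free)
  where open MaximumMatching E f g f-inj g-inj edges maximum
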